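{- Let $p$ be a prime, $q=p^{n}$, and $F=\mathrm{GF}(q)=\{a_{0}=0,a_{1},\dots,a_{q-1}\}$. For $c\in F$ let $f_{c}:F\to F$, $f_{c}(x)=cx$, and let $M(f_{c})$ be the $q\times q$ matrix over $F$, with rows and columns indexed by the elements of $F$, whose $(a,b)$ entry is $f_{c}(b-a)$. Let $H_{q}$ be the $q^{2}\times q^{2}$ block matrix $H_{q}=[H_{i,m}]_{0\le i,m\le q-1}$ whose $(i,m)$ block is $H_{i,m}=M(f_{a_{i}+a_{m}})$. Then $H_{q}$ is a $\mathrm{GH}(q,q)$ over the additive group of $F$.
   Context: For a finite additive abelian group $U$ of order $u$ and a positive integer $\lambda$, a generalized Hadamard matrix $\mathrm{GH}(u,\lambda)$ over $U$ is a square matrix $[d_{ij}]$ of order $u\lambda$ with entries in $U$ such that for any two distinct rows $i\neq \ell$, the multiset $\{d_{ij}-d_{\ell j}: 1\le j\le u\lambda\}$ contains each element of $U$ exactly $\lambda$ times. -}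

module Defs where

open import Level using (Level; _⊔_)
open import Data.Nat using (ℕ; zero; suc) renaming (_*_ to _*ℕ_)
open import Data.Bool using (Bool; true; false)
open import Data.Fin using (Fin; remQuot) renaming (zero to fzero; suc to fsuc)
open import Data.Product using (Σ; ∃; _×_; _,_)
open import Relation.Nullary using (¬_)
open import Relation.Nullary.Decidable using (⌊_⌋)
open import Relation.Binary.Core using (Rel)
open import Relation.Binary.Definitions using (Decidable)
open import Relation.Binary.PropositionalEquality using (_≡_; _≢_)
open import Algebra.Bundles using (AbelianGroup; CommutativeRing)

private variable c ℓ : Level

count : ∀ {n} → (Fin n → Bool) → ℕ
count {zero}  f = 0
count {suc n} f with f fzero
... | true  = suc (count (λ j → f (fsuc j)))
... | false = count (λ j → f (fsuc j))

IsEnumeration : {A : Set c} → Rel A ℓ → (u : ℕ) → (Fin u → A) → Set (c ⊔ ℓ)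
IsEnumeration {A = A} _≈_ u e =
  (∀ i j → e i ≈ e j → i ≡ j) × (∀ (x : A) → ∃ λ i → e i ≈ x)

-- Generalized Hadamard matrix GH(u, λ) over a finite abelian group U of order u
-- (order witnessed by an enumeration), with decidable equality (needed to count).
module _ (U : AbelianGroup c ℓ) where
  open AbelianGroup U renaming (Carrier to G)

  IsGH : Decidable _≈_ → (u λ' : ℕ) → Σ (Fin u → G) (IsEnumeration _≈_ u) →
         (Fin (u *ℕ λ') → Fin (u *ℕ λ') → G) → Set c
  IsGH _≟_ u λ' _ D =
    ∀ (i l : Fin (u *ℕ λ')) → i ≢ l → ∀ (g : G) →
      count (λ j → ⌊ (D i j ∙ (D l j) ⁻¹) ≟ g ⌋) ≡ λ'

record IsField (R : CommutativeRing c ℓ) : Set (c ⊔ ℓ) where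
  open CommutativeRing R
  field
    0≉1     : ¬ (0# ≈ 1#)
    inverse : ∀ x → ¬ (x ≈ 0#) → ∃ λ y → (x * y) ≈ 1#

module _ (R : CommutativeRing c ℓ) where
  open CommutativeRing R renaming (Carrier to F)

  Mf : ∀ {q} → (a : Fin q → F) → F → Fin q → Fin q → F
  Mf a c' r s = c' * (a s - a r)

  -- H_q = [H_{i,m}], H_{i,m} = M(f_{a_i + a_m}); entry (r, s) of block (i, m)
  -- sits at row i*q + r and column m*q + s (Data.Fin.combine; we use its inverse remQuot).
  Hq : ∀ {q} → (a : Fin q → F) → Fin (q *ℕ q) → Fin (q *ℕ q) → F
  Hq {q} a I J = go (remQuot q I) (remQuot q J)
    where
      go : Fin q × Fin q → Fin q × Fin q → F
      go (i , r) (m , s) = Mf a (a i + a m) r s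

module Submission where

-- Index the rows of Hq by pairs (i, r) and its columns by (m, s), so that the entry is
-- (a_i + a_m)(a_s - a_r). Rows (i, r) and (l, r′) differ at column (m, s) by the affine function
-- α a_s + β a_m + κ with α = a_i - a_l and β = a_r′ - a_r, and (α, β) ≠ (0, 0) when the rows are
-- distinct. Such a function takes every value g exactly q times on F × F: if α ≠ 0, each block m
-- holds exactly one solution s; if α = 0, the value depends on m alone, so exactly one block is
-- filled with q solutions.

open import Defs
open import Level using (Level)
open import Data.Nat using (ℕ; _^_)
open import Data.Nat.Primality using (Prime)
open import Data.Fin using (Fin)
open import Data.Product using (Σ; _,_)
open import Relation.Binary.PropositionalEquality using (_≡_)
open import Relation.Binary.Definitions using (Decidable)
open import Algebra.Bundles using (CommutativeRing)

open import Data.Nat using (zero; suc)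
import Data.Nat as ℕ
import Data.Nat.Properties as ℕₚ
open import Data.Bool using (Bool; true; false; if_then_else_)
open import Data.Fin using (_↑ˡ_; _↑ʳ_; combine; remQuot; quotient; remainder)
  renaming (zero to fzero; suc to fsuc)
open import Data.Fin.Properties using (suc-injective; remQuot-combine; combine-remQuot)
open import Data.Product using (∃; _×_; proj₁)
open import Function using (_∘_; const; _⇔_; mk⇔)
open import Relation.Nullary using (¬_; Dec; yes; no)
open import Relation.Nullary.Decidable using (⌊_⌋; isYes≗does; does-⇔; dec-true)
open import Relation.Binary.Bundles using (Setoid)
open import Relation.Binary.PropositionalEquality
  using (_≢_; refl; sym; trans; cong; cong₂; module ≡-Reasoning)

private
  variable
    m n k : ℕ

count-cong : {f g : Fin n → Bool} → (∀ j → f j ≡ g j) → count f ≡ count g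
count-cong {zero}              f≗g = refl
count-cong {suc n} {f} {g} f≗g with f fzero | g fzero | f≗g fzero
... | true  | .true  | refl = cong suc (count-cong (f≗g ∘ fsuc))
... | false | .false | refl = count-cong (f≗g ∘ fsuc)

count-+ : ∀ m (f : Fin (m ℕ.+ n) → Bool) →
          count f ≡ count (f ∘ (_↑ˡ n)) ℕ.+ count (f ∘ (m ↑ʳ_))
count-+ zero    f = refl
count-+ (suc m) f with f fzero
... | true  = cong suc (count-+ m (f ∘ fsuc))
... | false = count-+ m (f ∘ fsuc)

count-const : ∀ n b → count {n} (const b) ≡ (if b then n else 0)
count-const zero    true  = refl
count-const zero    false = refl
count-const (suc n) true  = cong suc (count-const n true)
count-const (suc n) false = count-const n false

count≡0 : (f : Fin n → Bool) → (∀ j → f j ≡ false) → count f ≡ 0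
count≡0 {zero}  f f≗false = refl
count≡0 {suc n} f f≗false with f fzero | f≗false fzero
... | false | refl = count≡0 (f ∘ fsuc) (f≗false ∘ fsuc)

count≡1 : (f : Fin n → Bool) (i : Fin n) → f i ≡ true →
          (∀ j → f j ≡ true → j ≡ i) → count f ≡ 1
count≡1 {suc n} f fzero fi≡true only-i with f fzero
... | true  = cong suc (count≡0 (f ∘ fsuc) others-false)
  where
  others-false : ∀ j → f (fsuc j) ≡ false
  others-false j with f (fsuc j) in fj≡true
  ... | false = refl
  ... | true  with () ← only-i (fsuc j) fj≡true
count≡1 {suc n} f (fsuc i) fi≡true only-i with f fzero in f0≡true
... | true  with () ← only-i fzero f0≡true
... | false = count≡1 (f ∘ fsuc) i fi≡true (λ j fj≡true → suc-injective (only-i (fsuc j) fj≡true))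

count-combine-uniform : (f : Fin (m ℕ.* n) → Bool) →
                        (∀ (i : Fin m) → count (f ∘ combine {n = n} i) ≡ k) → count f ≡ m ℕ.* k
count-combine-uniform {zero}      f rows = refl
count-combine-uniform {suc m} {n} f rows =
  trans (count-+ {m ℕ.* n} n f)
        (cong₂ ℕ._+_ (rows fzero) (count-combine-uniform {m} {n} (f ∘ (n ↑ʳ_)) (rows ∘ fsuc)))

count-suc-* : (b : Fin (suc m) → Bool) →
              count b ℕ.* n ≡ (if b fzero then n else 0) ℕ.+ count (b ∘ fsuc) ℕ.* n
count-suc-* b with b fzero
... | true  = refl
... | false = refl

count-combine-constʳ : (f : Fin (m ℕ.* n) → Bool) (b : Fin m → Bool) →
                       (∀ (i : Fin m) (j : Fin n) → f (combine i j) ≡ b i) → count f ≡ count b ℕ.* n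
count-combine-constʳ {zero}      f b f≗b = refl
count-combine-constʳ {suc m} {n} f b f≗b = begin
  count f                                                         ≡⟨ count-+ {m ℕ.* n} n f ⟩
  count (f ∘ combine {suc m} {n} fzero) ℕ.+ count (f ∘ (n ↑ʳ_))   ≡⟨ cong₂ ℕ._+_ first-row rest ⟩
  (if b fzero then n else 0) ℕ.+ count (b ∘ fsuc) ℕ.* n           ≡⟨ count-suc-* b ⟨
  count b ℕ.* n                                                   ∎
  where
  open ≡-Reasoning
  first-row : count (f ∘ combine {suc m} {n} fzero) ≡ (if b fzero then n else 0)
  first-row = trans (count-cong (f≗b fzero)) (count-const n (b fzero))
  rest : count (f ∘ (n ↑ʳ_)) ≡ count (b ∘ fsuc) ℕ.* n
  rest = count-combine-constʳ {m} {n} (f ∘ (n ↑ʳ_)) (b ∘ fsuc) (f≗b ∘ fsuc)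

⌊⌋-⇔ : ∀ {a b} {A : Set a} {B : Set b} → A ⇔ B → (a? : Dec A) (b? : Dec B) → ⌊ a? ⌋ ≡ ⌊ b? ⌋
⌊⌋-⇔ A⇔B a? b? = trans (isYes≗does a?) (trans (does-⇔ A⇔B a? b?) (sym (isYes≗does b?)))

module _ {c ℓ : Level} (S : Setoid c ℓ) (_≟_ : Decidable (Setoid._≈_ S)) where
  open Setoid S renaming (Carrier to A; sym to ≈-sym; trans to ≈-trans)

  ⌊≟⌋-congˡ : ∀ {x y} → x ≈ y → ∀ g → ⌊ x ≟ g ⌋ ≡ ⌊ y ≟ g ⌋
  ⌊≟⌋-congˡ x≈y g = ⌊⌋-⇔ (mk⇔ (≈-trans (≈-sym x≈y)) (≈-trans x≈y)) (_ ≟ g) (_ ≟ g)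

  count-enumeration : {a : Fin n → A} → IsEnumeration _≈_ n a →
                      ∀ t → count (λ s → ⌊ a s ≟ t ⌋) ≡ 1
  count-enumeration {a = a} (injective , surjective) t with surjective t
  ... | i , ai≈t = count≡1 _ i (trans (isYes≗does (a i ≟ t)) (dec-true (a i ≟ t) ai≈t)) only-i
    where
    only-i : ∀ j → ⌊ a j ≟ t ⌋ ≡ true → j ≡ i
    only-i j aj≟t with a j ≟ t
    ... | yes aj≈t = injective j i (≈-trans aj≈t (≈-sym ai≈t))

module _ {c ℓ : Level} (R : CommutativeRing c ℓ) where
  open CommutativeRing R
  open import Relation.Binary.Reasoning.Setoid setoid
  open import Algebra.Properties.Ring ring using (x[y-z]≈xy-xz; [y-z]x≈yx-zx)
  open import Algebra.Properties.Group +-group using (//-rightDividesˡ; //-rightDividesʳ)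
  open import Algebra.Properties.CommutativeSemigroup +-commutativeSemigroup using (x∙yz≈z∙yx)

  [x-y]+[y-z]≈x-z : ∀ x y z → (x - y) + (y - z) ≈ x - z
  [x-y]+[y-z]≈x-z x y z = begin
    (x - y) + (y - z)  ≈⟨ +-assoc (x - y) y (- z) ⟨
    ((x - y) + y) - z  ≈⟨ +-congʳ (//-rightDividesˡ y x) ⟩
    x - z              ∎

  [x+z]-[y+z]≈x-y : ∀ x y z → (x + z) - (y + z) ≈ x - y
  [x+z]-[y+z]≈x-y x y z = begin
    (x + z) - (y + z)                ≈⟨ +-congʳ (+-congʳ (//-rightDividesˡ y x)) ⟨
    (((x - y) + y) + z) - (y + z)    ≈⟨ +-congʳ (+-assoc (x - y) y z) ⟩
    ((x - y) + (y + z)) - (y + z)    ≈⟨ //-rightDividesʳ (y + z) (x - y) ⟩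
    x - y                            ∎

  [z-x]-[z-y]≈y-x : ∀ x y z → (z - x) - (z - y) ≈ y - x
  [z-x]-[z-y]≈y-x x y z = begin
    (z - x) - (z - y)                ≈⟨ +-congʳ ([x-y]+[y-z]≈x-z z y x) ⟨
    ((z - y) + (y - x)) - (z - y)    ≈⟨ +-congʳ (+-comm (z - y) (y - x)) ⟩
    ((y - x) + (z - y)) - (z - y)    ≈⟨ //-rightDividesʳ (z - y) (y - x) ⟩
    y - x                            ∎

  xy-x′y′≈[x-x′]y+x′[y-y′] : ∀ x x′ y y′ → x * y - x′ * y′ ≈ (x - x′) * y + x′ * (y - y′)
  xy-x′y′≈[x-x′]y+x′[y-y′] x x′ y y′ = begin
    x * y - x′ * y′                          ≈⟨ [x-y]+[y-z]≈x-z (x * y) (x′ * y) (x′ * y′) ⟨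
    (x * y - x′ * y) + (x′ * y - x′ * y′)    ≈⟨ +-cong ([y-z]x≈yx-zx y x x′) (x[y-z]≈xy-xz x′ y y′) ⟨
    (x - x′) * y + x′ * (y - y′)             ∎

  [u+x][y-v]-[u′+x][y-v′]-affine : ∀ u u′ v v′ x y →
    (u + x) * (y - v) - (u′ + x) * (y - v′)
      ≈ (u - u′) * y + ((v′ - v) * x + (u′ * (v′ - v) - (u - u′) * v))
  [u+x][y-v]-[u′+x][y-v′]-affine u u′ v v′ x y = begin
    (u + x) * (y - v) - (u′ + x) * (y - v′)
      ≈⟨ xy-x′y′≈[x-x′]y+x′[y-y′] (u + x) (u′ + x) (y - v) (y - v′) ⟩
    ((u + x) - (u′ + x)) * (y - v) + (u′ + x) * ((y - v) - (y - v′))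
      ≈⟨ +-cong (*-congʳ ([x+z]-[y+z]≈x-y u u′ x)) (*-congˡ ([z-x]-[z-y]≈y-x v v′ y)) ⟩
    α * (y - v) + (u′ + x) * β
      ≈⟨ +-cong (x[y-z]≈xy-xz α y v) (distribʳ β u′ x) ⟩
    (α * y - α * v) + (u′ * β + x * β)
      ≈⟨ +-assoc (α * y) (- (α * v)) (u′ * β + x * β) ⟩
    α * y + (- (α * v) + (u′ * β + x * β))
      ≈⟨ +-congˡ (x∙yz≈z∙yx (- (α * v)) (u′ * β) (x * β)) ⟩
    α * y + (x * β + (u′ * β - α * v))
      ≈⟨ +-congˡ (+-congʳ (*-comm x β)) ⟩
    α * y + (β * x + (u′ * β - α * v))
      ∎
    where
    α β : Carrier
    α = u - u′
    β = v′ - v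

module _ {c ℓ : Level} (F : CommutativeRing c ℓ) (isField : IsField F) where
  open CommutativeRing F
  open IsField isField using (inverse)
  open import Relation.Binary.Reasoning.Setoid setoid
  open import Algebra.Properties.Group +-group using (//-rightDividesˡ; //-rightDividesʳ)
  open import Algebra.Properties.CommutativeSemigroup *-commutativeSemigroup using (x∙yz≈y∙xz)

  affine-unique-root : ∀ {α} → ¬ α ≈ 0# → ∀ κ g → ∃ λ t → ∀ z → (α * z + κ ≈ g) ⇔ (z ≈ t)
  affine-unique-root {α} α≉0 κ g with inverse α α≉0
  ... | α⁻¹ , αα⁻¹≈1 = α⁻¹ * (g - κ) , λ z → mk⇔ to from
    where
    α[α⁻¹w]≈w : ∀ w → α * (α⁻¹ * w) ≈ w
    α[α⁻¹w]≈w w = begin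
      α * (α⁻¹ * w)  ≈⟨ *-assoc α α⁻¹ w ⟨
      (α * α⁻¹) * w  ≈⟨ *-congʳ αα⁻¹≈1 ⟩
      1# * w         ≈⟨ *-identityˡ w ⟩
      w              ∎
    to : ∀ {z} → α * z + κ ≈ g → z ≈ α⁻¹ * (g - κ)
    to {z} αz+κ≈g = begin
      z                       ≈⟨ α[α⁻¹w]≈w z ⟨
      α * (α⁻¹ * z)           ≈⟨ x∙yz≈y∙xz α α⁻¹ z ⟩
      α⁻¹ * (α * z)           ≈⟨ *-congˡ (//-rightDividesʳ κ (α * z)) ⟨
      α⁻¹ * ((α * z + κ) - κ) ≈⟨ *-congˡ (+-congʳ αz+κ≈g) ⟩
      α⁻¹ * (g - κ)           ∎
    from : ∀ {z} → z ≈ α⁻¹ * (g - κ) → α * z + κ ≈ g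
    from {z} z≈t = begin
      α * z + κ                ≈⟨ +-congʳ (*-congˡ z≈t) ⟩
      α * (α⁻¹ * (g - κ)) + κ  ≈⟨ +-congʳ (α[α⁻¹w]≈w (g - κ)) ⟩
      (g - κ) + κ              ≈⟨ //-rightDividesˡ κ g ⟩
      g                        ∎

module _ {c ℓ : Level} (F : CommutativeRing c ℓ) (isField : IsField F)
         (_≟_ : Decidable (CommutativeRing._≈_ F))
         {q : ℕ} {a : Fin q → CommutativeRing.Carrier F}
         (enum : IsEnumeration (CommutativeRing._≈_ F) q a) where
  open CommutativeRing F renaming (sym to ≈-sym; trans to ≈-trans)
  open import Algebra.Properties.Group +-group using (x∙y⁻¹≈ε⇒x≈y)

  count-affine : ∀ {α} → ¬ α ≈ 0# → ∀ κ g → count (λ s → ⌊ (α * a s + κ) ≟ g ⌋) ≡ 1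
  count-affine α≉0 κ g with affine-unique-root F isField α≉0 κ g
  ... | t , root⇔ =
    trans (count-cong (λ s → ⌊⌋-⇔ (root⇔ (a s)) _ _)) (count-enumeration setoid _≟_ enum t)

  affine-hits : Carrier → Carrier → Carrier → Carrier → Fin q × Fin q → Bool
  affine-hits α β κ g (m , s) = ⌊ (α * a s + (β * a m + κ)) ≟ g ⌋

  count-affine₂ : ∀ {α β} → ¬ (α ≈ 0# × β ≈ 0#) → ∀ κ g →
                  count (affine-hits α β κ g ∘ remQuot q) ≡ q
  count-affine₂ {α} {β} nondegenerate κ g with α ≟ 0#
  ... | no α≉0 =
    trans (count-combine-uniform {q} {q} _ rows) (ℕₚ.*-identityʳ q)
    where
    rows : ∀ m → count (affine-hits α β κ g ∘ remQuot q ∘ combine m) ≡ 1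
    rows m = trans (count-cong (cong (affine-hits α β κ g) ∘ remQuot-combine m))
                   (count-affine α≉0 (β * a m + κ) g)
  ... | yes α≈0 =
    trans (count-combine-constʳ {q} {q} _ _ columns-irrelevant)
          (trans (cong (ℕ._* q) (count-affine β≉0 κ g)) (ℕₚ.*-identityˡ q))
    where
    β≉0 : ¬ β ≈ 0#
    β≉0 β≈0 = nondegenerate (α≈0 , β≈0)
    αy+w≈w : ∀ y w → α * y + w ≈ w
    αy+w≈w y w = ≈-trans (+-congʳ (≈-trans (*-congʳ α≈0) (zeroˡ y))) (+-identityˡ w)
    columns-irrelevant : ∀ m s → affine-hits α β κ g (remQuot q (combine m s))
                                 ≡ ⌊ (β * a m + κ) ≟ g ⌋
    columns-irrelevant m s = trans (cong (affine-hits α β κ g) (remQuot-combine m s))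
                                   (⌊≟⌋-congˡ setoid _≟_ (αy+w≈w (a s) _) g)

  distinct-rows⇒nondegenerate : ∀ {I L : Fin (q ℕ.* q)} → I ≢ L →
    ¬ (a (quotient {q} q I) - a (quotient {q} q L) ≈ 0#
       × a (remainder {q} q L) - a (remainder {q} q I) ≈ 0#)
  distinct-rows⇒nondegenerate {I} {L} I≢L (α≈0 , β≈0) = I≢L (begin
    I                                               ≡⟨ combine-remQuot {q} q I ⟨
    combine (quotient {q} q I) (remainder {q} q I)  ≡⟨ cong₂ combine i≡l r≡r′ ⟩
    combine (quotient {q} q L) (remainder {q} q L)  ≡⟨ combine-remQuot {q} q L ⟩
    L                                               ∎)
    where
    open ≡-Reasoning
    i≡l : quotient {q} q I ≡ quotient {q} q L
    i≡l = proj₁ enum _ _ (x∙y⁻¹≈ε⇒x≈y _ _ α≈0)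
    r≡r′ : remainder {q} q I ≡ remainder {q} q L
    r≡r′ = sym (proj₁ enum _ _ (x∙y⁻¹≈ε⇒x≈y _ _ β≈0))

theorem3p2 : ∀ {c ℓ : Level} (p n q : ℕ) → Prime p → q ≡ p ^ n →
    (F : CommutativeRing c ℓ) → IsField F →
    (_≟_ : Decidable (CommutativeRing._≈_ F)) →
    (a : Fin q → CommutativeRing.Carrier F) →
    (enum : IsEnumeration (CommutativeRing._≈_ F) q a) →
    IsGH (CommutativeRing.+-abelianGroup F) _≟_ q q (a , enum) (Hq F a)
theorem3p2 _ _ q _ _ F isField _≟_ a enum I L I≢L g =
  trans (count-cong (λ J → ⌊≟⌋-congˡ setoid _≟_ (rows-difference (remQuot q J)) g))
        (count-affine₂ F isField _≟_ enum (distinct-rows⇒nondegenerate F isField _≟_ enum I≢L) κ g)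
  where
  open CommutativeRing F using (Carrier; setoid; _≈_; _+_; _-_; _*_)
  i r l r′ : Fin q
  i  = quotient {q} q I
  r  = remainder {q} q I
  l  = quotient {q} q L
  r′ = remainder {q} q L
  κ : Carrier
  κ = a l * (a r′ - a r) - (a i - a l) * a r
  rows-difference : ∀ ((m , s) : Fin q × Fin q) →
    (a i + a m) * (a s - a r) - (a l + a m) * (a s - a r′)
      ≈ (a i - a l) * a s + ((a r′ - a r) * a m + κ)
  rows-difference (m , s) = [u+x][y-v]-[u′+x][y-v′]-affine F (a i) (a l) (a r) (a r′) (a m) (a s)
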